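{- For every $n \geq 2$, the DCell graph $D_{1,n}$ is vertex-transitive.
   Context: DCell graphs $D_{k,n}$ ($k \geq 0$, $n \geq 2$) are defined recursively. $D_{0,n}$ is the complete graph $K_n$ on vertices labeled $0,1,\dots,n-1$. Let $t_{k,n}$ denote the number of vertices of $D_{k,n}$. For $k \geq 1$, $D_{k,n}$ consists of $t_{k-1,n}+1$ disjoint copies $D^i_{k-1,n}$, $i = 0,1,\dots,t_{k-1,n}$, of $D_{k-1,n}$; a vertex of $D^i_{k-1,n}$ is labeled $(i,a_{k-1},\dots,a_0)$, where $(a_{k-1},\dots,a_0)$ is its label in $D_{k-1,n}$ (so $a_0 \in \{0,\dots,n-1\}$). For a suffix $(a_j,\dots,a_0)$ define $uid_j = a_0 + \sum_{l=1}^{j} a_l\, t_{l-1,n}$. Besides the edges inside the copies, for every pair $a<b$ of copy indices there is exactly one additional edge (a level $k$ edge), joining the vertex of $D^a_{k-1,n}$ whose suffix has $uid_{k-1} = b-1$ to the vertex of $D^b_{k-1,n}$ whose suffix has $uid_{k-1} = a$. A graph is vertex-transitive if its automorphism group acts transitively on its vertices. -}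

module Defs where

open import Data.Nat using (ℕ; zero; suc; _+_; _*_; _∸_; _<_)
open import Data.Fin using (Fin; toℕ)
open import Data.Product using (Σ; _×_; _,_; ∃)
open import Data.Sum using (_⊎_)
open import Relation.Binary.PropositionalEquality using (_≡_; _≢_)
open import Function.Bundles using (Bijection; _⤖_; _⇔_)

record Automorphism (V : Set) (E : V → V → Set) : Set where
  field
    bij      : V ⤖ V
    preserve : ∀ x y → E x y ⇔ E (Bijection.to bij x) (Bijection.to bij y)

open Automorphism public

VertexTransitive : (V : Set) → (V → V → Set) → Set
VertexTransitive V E =
  ∀ (u v : V) → Σ (Automorphism V E) λ φ → Bijection.to (bij φ) u ≡ v

-- t k n = number of vertices of D_{k,n}
t : ℕ → ℕ → ℕ
t zero    n = n
t (suc k) n = (t k n + 1) * t k n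

-- Vertex labels of D_{k,n}: D_{0,n} has labels 0..n-1;
-- D_{k+1,n} has labels (i , a_k,...,a_0) with i ∈ {0,...,t k n}.
Label : ℕ → ℕ → Set
Label zero    n = Fin n
Label (suc k) n = Fin (t k n + 1) × Label k n

uid : ∀ k n → Label k n → ℕ
uid zero    n a       = toℕ a
uid (suc k) n (i , x) = toℕ i * t k n + uid k n x

DCellAdj : ∀ k n → Label k n → Label k n → Set
DCellAdj zero    n a b = a ≢ b
DCellAdj (suc k) n (i , x) (j , y) =
  -- edge inside a copy D^i_{k,n}
  (i ≡ j × DCellAdj k n x y)
  -- level (k+1) edge between copies i < j
  ⊎ (toℕ i < toℕ j × uid k n x ≡ toℕ j ∸ 1 × uid k n y ≡ toℕ i)
  -- the same edge seen from the other end (j < i)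
  ⊎ (toℕ j < toℕ i × uid k n y ≡ toℕ i ∸ 1 × uid k n x ≡ toℕ j)

-- A vertex (i , a) of D_{1,n} lies in copy i, and its level-1 edge leads to copy c = punchIn i a,
-- the a-th copy other than i. So (i , a) ↦ (i , c) identifies D_{1,n} with the graph on ordered
-- pairs of distinct elements of an (n+1)-set in which (i , c) ~ (j , d) iff i = j, or c = j and
-- d = i. Every permutation of the copies preserves this description, and the symmetric group acts
-- transitively on ordered pairs of distinct elements.
module Submission where

open import Defs
open import Data.Nat as ℕ using (ℕ; suc; _∸_; _≤_; _<_; s≤s; s≤s⁻¹)
open import Data.Nat.Properties using (+-comm; <-cmp; <-asym; ≤-trans; <⇒≱; ≮⇒≥; n≤1+n; suc-injective)
open import Data.Fin using (Fin; toℕ; punchIn; _≟_)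
open import Data.Fin.Properties using (toℕ-injective; punchIn-injective; punchInᵢ≢i)
open import Data.Fin.Permutation using (Permutation; Permutation′; _⟨$⟩ʳ_; _⟨$⟩ˡ_; flip; inverseˡ; remove; insert; transpose; punchIn-permute; remove-insert)
open import Data.Product using (Σ; _×_; _,_; proj₁; proj₂; map; swap)
open import Data.Product.Function.NonDependent.Propositional using (_×-⇔_)
open import Data.Sum using (_⊎_; inj₁; inj₂)
open import Function.Base using (_∘_)
open import Function.Bundles using (_⇔_; mk⇔; Equivalence; Injection; mk↔ₛ′)
open import Function.Construct.Composition using (_⇔-∘_)
open import Function.Construct.Symmetry using (⇔-sym)
open import Function.Definitions using (Injective)
open import Function.Properties.Inverse using (↔⇒⤖; ↔⇒↣)
open import Relation.Binary.Definitions using (tri<; tri≈; tri>)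
open import Relation.Binary.PropositionalEquality
open import Relation.Nullary using (yes; no; contradiction)
open import Relation.Nullary.Decidable using (dec-true)

PairAdj : {A : Set} → A × A → A × A → Set
PairAdj (i , c) (j , d) = (i ≡ j × c ≢ d) ⊎ (c ≡ j × d ≡ i)

PairAdj-map⇔ : {A B : Set} (f : A → B) → Injective _≡_ _≡_ f →
               ∀ p q → PairAdj p q ⇔ PairAdj (map f f p) (map f f q)
PairAdj-map⇔ f f-inj (i , c) (j , d) = mk⇔ forth back
  where
  forth : PairAdj (i , c) (j , d) → PairAdj (f i , f c) (f j , f d)
  forth (inj₁ (i≡j , c≢d)) = inj₁ (cong f i≡j , c≢d ∘ f-inj)
  forth (inj₂ (c≡j , d≡i)) = inj₂ (cong f c≡j , cong f d≡i)

  back : PairAdj (f i , f c) (f j , f d) → PairAdj (i , c) (j , d)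
  back (inj₁ (fi≡fj , fc≢fd)) = inj₁ (f-inj fi≡fj , fc≢fd ∘ cong f)
  back (inj₂ (fc≡fj , fd≡fi)) = inj₂ (f-inj fc≡fj , f-inj fd≡fi)

-- `DCellAdj 1 n` unfolds to `DCell₁Adj (n + 1) n`; the number of copies is kept abstract
-- so that it can be rewritten to `suc n`.
DCell₁Adj : ∀ M n → Fin M × Fin n → Fin M × Fin n → Set
DCell₁Adj M n (i , a) (j , b) =
    (i ≡ j × a ≢ b)
  ⊎ (toℕ i < toℕ j × toℕ a ≡ toℕ j ∸ 1 × toℕ b ≡ toℕ i)
  ⊎ (toℕ j < toℕ i × toℕ b ≡ toℕ i ∸ 1 × toℕ a ≡ toℕ j)

arc : ∀ {m} → Fin (suc m) × Fin m → Fin (suc m) × Fin (suc m)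
arc (i , a) = i , punchIn i a

arc-injective : ∀ {m} → Injective _≡_ _≡_ (arc {m})
arc-injective {x = i , a} {y = j , b} arcx≡arcy with refl ← cong proj₁ arcx≡arcy =
  cong (i ,_) (punchIn-injective i a b (cong proj₂ arcx≡arcy))

toℕ-punchIn-< : ∀ {m} (i : Fin (suc m)) (a : Fin m) → toℕ a < toℕ i → toℕ (punchIn i a) ≡ toℕ a
toℕ-punchIn-< Fin.zero    a           ()
toℕ-punchIn-< (Fin.suc i) Fin.zero    a<i       = refl
toℕ-punchIn-< (Fin.suc i) (Fin.suc a) (s≤s a<i) = cong suc (toℕ-punchIn-< i a a<i)

toℕ-punchIn-≥ : ∀ {m} (i : Fin (suc m)) (a : Fin m) → toℕ i ≤ toℕ a → toℕ (punchIn i a) ≡ suc (toℕ a)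
toℕ-punchIn-≥ Fin.zero    a           i≤a       = refl
toℕ-punchIn-≥ (Fin.suc i) (Fin.suc a) (s≤s i≤a) = cong suc (toℕ-punchIn-≥ i a i≤a)

punchIn≡-below : ∀ {m} {i j : Fin (suc m)} (a : Fin m) → toℕ j < toℕ i →
                 punchIn i a ≡ j ⇔ toℕ a ≡ toℕ j
punchIn≡-below {i = i} {j} a j<i = mk⇔ forth back
  where
  forth : punchIn i a ≡ j → toℕ a ≡ toℕ j
  forth refl with toℕ a ℕ.<? toℕ i
  ... | yes a<i = sym (toℕ-punchIn-< i a a<i)
  ... | no  a≮i = contradiction i≤punchIn (<⇒≱ j<i)
    where
    i≤punchIn : toℕ i ≤ toℕ (punchIn i a)
    i≤punchIn = subst (toℕ i ≤_) (sym (toℕ-punchIn-≥ i a (≮⇒≥ a≮i))) (≤-trans (≮⇒≥ a≮i) (n≤1+n _))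

  back : toℕ a ≡ toℕ j → punchIn i a ≡ j
  back a≡j = toℕ-injective (trans (toℕ-punchIn-< i a (subst (_< toℕ i) (sym a≡j) j<i)) a≡j)

punchIn≡-above : ∀ {m} {i j : Fin (suc m)} (a : Fin m) → toℕ i < toℕ j →
                 punchIn i a ≡ j ⇔ toℕ a ≡ toℕ j ∸ 1
punchIn≡-above {j = Fin.zero}  a ()
punchIn≡-above {i = i} {Fin.suc j} a i<j = mk⇔ forth back
  where
  forth : punchIn i a ≡ Fin.suc j → toℕ a ≡ toℕ j
  forth e with toℕ a ℕ.<? toℕ i
  ... | yes a<i = contradiction i<j (<-asym j<i)
    where
    j<i : toℕ (Fin.suc j) < toℕ i
    j<i = subst (_< toℕ i) (trans (sym (toℕ-punchIn-< i a a<i)) (cong toℕ e)) a<i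
  ... | no  a≮i = suc-injective (trans (sym (toℕ-punchIn-≥ i a (≮⇒≥ a≮i))) (cong toℕ e))

  back : toℕ a ≡ toℕ j → punchIn i a ≡ Fin.suc j
  back a≡j = toℕ-injective (trans (toℕ-punchIn-≥ i a (subst (toℕ i ≤_) (sym a≡j) (s≤s⁻¹ i<j))) (cong suc a≡j))

levelEdge⇔ : ∀ {m} {i j : Fin (suc m)} (a b : Fin m) → toℕ i < toℕ j →
             (toℕ a ≡ toℕ j ∸ 1 × toℕ b ≡ toℕ i) ⇔ (punchIn i a ≡ j × punchIn j b ≡ i)
levelEdge⇔ a b i<j = ⇔-sym (punchIn≡-above a i<j ×-⇔ punchIn≡-below b i<j)

DCell₁Adj⇔PairAdj : ∀ {m} x y → DCell₁Adj (suc m) m x y ⇔ PairAdj (arc x) (arc y)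
DCell₁Adj⇔PairAdj (i , a) (j , b) = mk⇔ forth back
  where
  forth : DCell₁Adj _ _ (i , a) (j , b) → PairAdj (arc (i , a)) (arc (j , b))
  forth (inj₁ (refl , a≢b))             = inj₁ (refl , a≢b ∘ punchIn-injective i a b)
  forth (inj₂ (inj₁ (i<j , edge)))      = inj₂ (Equivalence.to (levelEdge⇔ a b i<j) edge)
  forth (inj₂ (inj₂ (j<i , eb , ea)))   = inj₂ (swap (Equivalence.to (levelEdge⇔ b a j<i) (eb , ea)))

  back : PairAdj (arc (i , a)) (arc (j , b)) → DCell₁Adj _ _ (i , a) (j , b)
  back (inj₁ (refl , c≢d)) = inj₁ (refl , c≢d ∘ cong (punchIn i))
  back (inj₂ (c≡j , d≡i)) with <-cmp (toℕ i) (toℕ j)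
  ... | tri< i<j _ _ = inj₂ (inj₁ (i<j , Equivalence.from (levelEdge⇔ a b i<j) (c≡j , d≡i)))
  ... | tri> _ _ j<i = inj₂ (inj₂ (j<i , Equivalence.from (levelEdge⇔ b a j<i) (d≡i , c≡j)))
  ... | tri≈ _ i≡j _ = contradiction (trans c≡j (sym (toℕ-injective i≡j))) (punchInᵢ≢i i a)

module _ {m} (π : Permutation′ (suc m)) where

  act : Fin (suc m) × Fin m → Fin (suc m) × Fin m
  act (i , a) = π ⟨$⟩ʳ i , remove i π ⟨$⟩ʳ a

  arc-act : ∀ x → arc (act x) ≡ map (π ⟨$⟩ʳ_) (π ⟨$⟩ʳ_) (arc x)
  arc-act (i , a) = cong (π ⟨$⟩ʳ i ,_) (sym (punchIn-permute π i a))

  act-preserves-adjacency : ∀ x y → DCell₁Adj (suc m) m x y ⇔ DCell₁Adj (suc m) m (act x) (act y)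
  act-preserves-adjacency x y =
    ⇔-sym (DCell₁Adj⇔PairAdj (act x) (act y)) ⇔-∘ (permuted ⇔-∘ DCell₁Adj⇔PairAdj x y)
    where
    permuted : PairAdj (arc x) (arc y) ⇔ PairAdj (arc (act x)) (arc (act y))
    permuted = subst₂ (λ p q → PairAdj (arc x) (arc y) ⇔ PairAdj p q) (sym (arc-act x)) (sym (arc-act y))
                 (PairAdj-map⇔ (π ⟨$⟩ʳ_) (Injection.injective (↔⇒↣ π)) (arc x) (arc y))

act-flip : ∀ {m} (π : Permutation′ (suc m)) x → act (flip π) (act π x) ≡ x
act-flip π x = arc-injective (begin
  arc (act (flip π) (act π x))                              ≡⟨ arc-act (flip π) (act π x) ⟩
  map (π ⟨$⟩ˡ_) (π ⟨$⟩ˡ_) (arc (act π x))                     ≡⟨ cong (map (π ⟨$⟩ˡ_) (π ⟨$⟩ˡ_)) (arc-act π x) ⟩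
  map (π ⟨$⟩ˡ_) (π ⟨$⟩ˡ_) (map (π ⟨$⟩ʳ_) (π ⟨$⟩ʳ_) (arc x)) ≡⟨ cong₂ _,_ (inverseˡ π) (inverseˡ π) ⟩
  arc x                                                     ∎)
  where open ≡-Reasoning

automorphism : ∀ {m} → Permutation′ (suc m) → Automorphism (Fin (suc m) × Fin m) (DCell₁Adj (suc m) m)
automorphism π = record
  { bij      = ↔⇒⤖ (mk↔ₛ′ (act π) (act (flip π)) (act-flip (flip π)) (act-flip π))
  ; preserve = act-preserves-adjacency π
  }

insert-i↦j : ∀ {m n} (i : Fin (suc m)) (j : Fin (suc n)) (π : Permutation m n) → insert i j π ⟨$⟩ʳ i ≡ j
insert-i↦j i j π with i ≟ i
... | yes _   = refl
... | no  i≢i = contradiction refl i≢i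

transpose-i↦j : ∀ {n} (i j : Fin n) → transpose i j ⟨$⟩ʳ i ≡ j
transpose-i↦j i j rewrite dec-true (i ≟ i) refl = refl

act-transitive : ∀ {m} (u v : Fin (suc m) × Fin m) → Σ (Permutation′ (suc m)) λ π → act π u ≡ v
act-transitive {m} (i , a) (j , b) =
  insert i j τ , cong₂ _,_ (insert-i↦j i j τ) (trans (remove-insert i j τ a) (transpose-i↦j a b))
  where
  τ : Permutation′ m
  τ = transpose a b

dcell₁-vertexTransitive : ∀ m → VertexTransitive (Fin (suc m) × Fin m) (DCell₁Adj (suc m) m)
dcell₁-vertexTransitive m u v with π , πu≡v ← act-transitive u v = automorphism π , πu≡v

corollary3 : ∀ (n : ℕ) → 2 ≤ n → VertexTransitive (Label 1 n) (DCellAdj 1 n)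
corollary3 n _ =
  subst (λ M → VertexTransitive (Fin M × Fin n) (DCell₁Adj M n)) (+-comm 1 n) (dcell₁-vertexTransitive n)
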